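{- Let $n \ge 2$ be an integer and suppose there exists a multiplicative orthomorphism modulo $n$. Then $n$ is squarefree.
   Context: For an integer $n \ge 2$, a multiplicative orthomorphism modulo $n$ is a permutation $\sigma$ of $\{1, \dots, n-1\}$ such that the map $x \mapsto x\sigma(x) \bmod n$ is also a bijection of $\{1, \dots, n-1\}$. -}

module Defs where

open import Data.Nat using (ℕ; _*_; _≤_; _<_; _%_; NonZero)
open import Data.Nat.Divisibility using (_∣_)
open import Data.Product using (_×_; ∃)
open import Relation.Binary.PropositionalEquality using (_≡_)

InRange : ℕ → ℕ → Set
InRange n x = 1 ≤ x × x < n

IsPermOfRange : ℕ → (ℕ → ℕ) → Set
IsPermOfRange n f =
  (∀ x → InRange n x → InRange n (f x)) ×
  (∀ x y → InRange n x → InRange n y → f x ≡ f y → x ≡ y) ×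
  (∀ y → InRange n y → ∃ λ x → InRange n x × f x ≡ y)

IsMultOrthomorphism : (n : ℕ) → .{{NonZero n}} → (ℕ → ℕ) → Set
IsMultOrthomorphism n σ =
  IsPermOfRange n σ × IsPermOfRange n (λ x → (x * σ x) % n)

SquareFree : ℕ → Set
SquareFree n = ∀ d → d * d ∣ n → d ≡ 1

module Submission where

-- Let σ be a multiplicative orthomorphism modulo n and g x = x σ(x) mod n.
-- Since g maps {1, …, n-1} into itself, n never divides x σ(x) there.
-- Suppose d² ∣ n with d ≥ 2 and write n = m d, so d ∣ m and m < n.
-- Taking x = m shows d ∤ σ(m), for otherwise n = m d ∣ m σ(m).
-- Now pick the m points x_i = σ⁻¹((i+1) d) for i < m - 1 together with
-- x_{m-1} = m.  They are distinct, because the σ(x_i) are distinct multiples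
-- of d while σ(m) is not a multiple of d; and d divides x σ(x) for each of
-- them, hence d ∣ g(x_i) because d ∣ n.  So g sends m distinct points
-- injectively to positive multiples of d below m d, of which there are only
-- m - 1.  The file first proves this counting fact (a pigeonhole principle on
-- ℕ and the description of positive multiples), then the consequences of the
-- orthomorphism property, and derives the theorem from them at the end.

open import Defs
open import Data.Nat using (ℕ; _≤_; NonZero)
open import Data.Product using (∃)

open import Data.Nat using (zero; suc; pred; _*_; _<_; _%_; _<?_; z≤n; s≤s; s<s⁻¹; ≢-nonZero⁻¹; >-nonZero⁻¹)
open import Data.Nat.Properties
  using (≤-trans; ≤-antisym; <-irrefl; ≮⇒≥; n<1+n; m<m*n; m*n≢0; suc-injective; *-cancelʳ-≡; *-cancelʳ-<; *-monoˡ-<; *-assoc)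
open import Data.Nat.Divisibility
  using (_∣_; divides; n∣m*n; *-monoʳ-∣; ∣m⇒∣m*n; ∣n⇒∣m*n; %-presˡ-∣; n∣m⇒m%n≡0; 0∣⇒≡0)
open import Data.Fin using (Fin; toℕ; fromℕ<)
open import Data.Fin.Properties using (pigeonhole; toℕ≤pred[n]; toℕ-fromℕ<)
open import Data.Product using (_,_; proj₁; proj₂; _×_)
open import Data.Sum using (_⊎_; inj₁; inj₂)
open import Data.Empty using (⊥; ⊥-elim)
open import Function using (_∘_)
open import Relation.Nullary using (¬_; yes; no)
open import Relation.Binary.PropositionalEquality using (_≡_; _≢_; refl; sym; trans; cong; subst)

InjectiveUpTo : ℕ → (ℕ → ℕ) → Set
InjectiveUpTo k f = ∀ {i j} → i ≤ k → j ≤ k → f i ≡ f j → i ≡ j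

pigeonhole-ℕ : ∀ k (f : ℕ → ℕ) → (∀ i → i ≤ k → f i < k) → ¬ InjectiveUpTo k f
pigeonhole-ℕ k f f<k f-inj =
  let (i , j , i<j , f̂i≡f̂j) = pigeonhole (n<1+n k) f̂
      fi≡fj = trans (sym (toℕ-fromℕ< _)) (trans (cong toℕ f̂i≡f̂j) (toℕ-fromℕ< _))
  in <-irrefl (f-inj (toℕ≤pred[n] i) (toℕ≤pred[n] j) fi≡fj) i<j
  where
  f̂ : Fin (suc k) → Fin k
  f̂ i = fromℕ< (f<k (toℕ i) (toℕ≤pred[n] i))

positiveMultiple : ∀ {d y} M → d ∣ y → 0 < y → y < suc M * d →
                   ∃ λ q → q < M × y ≡ suc q * d
positiveMultiple M (divides (suc q) refl) _ y<[M+1]d =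
  q , s<s⁻¹ (*-cancelʳ-< _ (suc q) (suc M) y<[M+1]d) , refl

noInjectionIntoMultiples : ∀ M d (F : ℕ → ℕ) →
  (∀ i → InRange (suc M * d) (F i) × d ∣ F i) → ¬ InjectiveUpTo M F
noInjectionIntoMultiples M d F F-multiple F-inj =
  pigeonhole-ℕ M index (λ i _ → proj₁ (proj₂ (decompose i))) index-inj
  where
  decompose : ∀ i → ∃ λ q → q < M × F i ≡ suc q * d
  decompose i with F-multiple i
  ... | (0<Fi , Fi<[M+1]d) , d∣Fi = positiveMultiple M d∣Fi 0<Fi Fi<[M+1]d

  index : ℕ → ℕ
  index = proj₁ ∘ decompose

  index-inj : InjectiveUpTo M index
  index-inj i≤M j≤M eq = F-inj i≤M j≤M (trans (proj₂ (proj₂ (decompose _)))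
    (trans (cong (λ q → suc q * d) eq) (sym (proj₂ (proj₂ (decompose _))))))

-- For an orthomorphism, n never divides x σ(x) when 1 ≤ x < n, since
-- x σ(x) mod n lies in {1, …, n-1}.
productNotDivisible : ∀ {n σ} .{{_ : NonZero n}} → IsMultOrthomorphism n σ →
                      ∀ {x} → InRange n x → ¬ n ∣ x * σ x
productNotDivisible {n} {σ} (_ , g-maps , _) {x} x∈ n∣xσx =
  <-irrefl (sym (n∣m⇒m%n≡0 (x * σ x) n n∣xσx)) (proj₁ (g-maps x x∈))

module NoSquareDivisor {n σ} .{{_ : NonZero n}} (ortho : IsMultOrthomorphism n σ)
  (M d : ℕ) .{{_ : NonZero d}} (1<d : 1 < d) (n≡md : n ≡ suc M * d) (d∣m : d ∣ suc M)
  where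

  m : ℕ
  m = suc M

  g : ℕ → ℕ
  g x = (x * σ x) % n

  σ-onto : ∀ y → InRange n y → ∃ λ x → InRange n x × σ x ≡ y
  σ-onto = proj₂ (proj₂ (proj₁ ortho))

  g-maps : ∀ x → InRange n x → InRange n (g x)
  g-maps = proj₁ (proj₂ ortho)

  g-injective : ∀ x y → InRange n x → InRange n y → g x ≡ g y → x ≡ y
  g-injective = proj₁ (proj₂ (proj₂ ortho))

  m∈ : InRange n m
  m∈ = s≤s z≤n , subst (m <_) (sym n≡md) (m<m*n m d 1<d)

  -- d ∤ σ(m): otherwise n = m d would divide m σ(m).
  d∤σm : ¬ d ∣ σ m
  d∤σm d∣σm = productNotDivisible ortho m∈ (subst (_∣ m * σ m) (sym n≡md) (*-monoʳ-∣ m d∣σm))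

  multiple∈ : ∀ {i} → i < M → InRange n (suc i * d)
  multiple∈ {i} i<M = >-nonZero⁻¹ (suc i * d) {{m*n≢0 (suc i) d}} ,
                      subst (suc i * d <_) (sym n≡md) (*-monoˡ-< d (s≤s i<M))

  x : ℕ → ℕ
  x i with i <? M
  ... | yes i<M = proj₁ (σ-onto (suc i * d) (multiple∈ i<M))
  ... | no _    = m

  x-cases : ∀ i → (i < M × σ (x i) ≡ suc i * d × InRange n (x i)) ⊎ (M ≤ i × x i ≡ m)
  x-cases i with i <? M
  ... | yes i<M = let (_ , x∈ , σx≡) = σ-onto (suc i * d) (multiple∈ i<M)
                  in inj₁ (i<M , σx≡ , x∈)
  ... | no i≮M  = inj₂ (≮⇒≥ i≮M , refl)

  x∈ : ∀ i → InRange n (x i)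
  x∈ i with x-cases i
  ... | inj₁ (_ , _ , x∈) = x∈
  ... | inj₂ (_ , x≡m)    = subst (InRange n) (sym x≡m) m∈

  d∣xσx : ∀ i → d ∣ x i * σ (x i)
  d∣xσx i with x-cases i
  ... | inj₁ (_ , σx≡ , _) = subst (λ y → d ∣ x i * y) (sym σx≡) (∣n⇒∣m*n (x i) (n∣m*n (suc i)))
  ... | inj₂ (_ , x≡m)     = subst (λ y → d ∣ y * σ y) (sym x≡m) (∣m⇒∣m*n (σ m) d∣m)

  d∣σ⇒≢m : ∀ {y} → d ∣ σ y → y ≢ m
  d∣σ⇒≢m d∣σy refl = d∤σm d∣σy

  -- The points x_0, …, x_M are distinct: the σ(x_i) with i < M are distinct
  -- multiples of d, and none of these points equals m.
  x-injective : InjectiveUpTo M x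
  x-injective {i} {j} i≤M j≤M xi≡xj with x-cases i | x-cases j
  ... | inj₁ (_ , σxi≡ , _) | inj₁ (_ , σxj≡ , _) =
    suc-injective (*-cancelʳ-≡ (suc i) (suc j) d (trans (sym σxi≡) (trans (cong σ xi≡xj) σxj≡)))
  ... | inj₁ (_ , σxi≡ , _) | inj₂ (_ , xj≡m) = ⊥-elim (d∣σ⇒≢m (divides (suc i) σxi≡) (trans xi≡xj xj≡m))
  ... | inj₂ (_ , xi≡m) | inj₁ (_ , σxj≡ , _) = ⊥-elim (d∣σ⇒≢m (divides (suc j) σxj≡) (trans (sym xi≡xj) xi≡m))
  ... | inj₂ (M≤i , _) | inj₂ (M≤j , _) = ≤-antisym (≤-trans i≤M M≤j) (≤-trans j≤M M≤i)

  impossible : ⊥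
  impossible = noInjectionIntoMultiples M d (g ∘ x) g∘x-multiple g∘x-injective
    where
    g∘x-multiple : ∀ i → InRange (suc M * d) (g (x i)) × d ∣ g (x i)
    g∘x-multiple i = subst (λ k → InRange k (g (x i))) n≡md (g-maps (x i) (x∈ i)) ,
                     %-presˡ-∣ (d∣xσx i) (subst (d ∣_) (sym n≡md) (n∣m*n m))

    g∘x-injective : InjectiveUpTo M (g ∘ x)
    g∘x-injective i≤M j≤M eq = x-injective i≤M j≤M (g-injective _ _ (x∈ _) (x∈ _) eq)

proposition2p2 : (n : ℕ) → .{{_ : NonZero n}} → 2 ≤ n →
                 (∃ λ σ → IsMultOrthomorphism n σ) → SquareFree n
-- d = 0 and the cofactor 0 are excluded by n ≠ 0; d = 1 is allowed;
-- d ≥ 2 with n = k d² contradicts the core argument with m = k d.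
proposition2p2 n _ _ zero 0∣n = ⊥-elim (≢-nonZero⁻¹ n (0∣⇒≡0 0∣n))
proposition2p2 n _ _ (suc zero) _ = refl
proposition2p2 n _ _ (suc (suc _)) (divides zero n≡0) = ⊥-elim (≢-nonZero⁻¹ n n≡0)
proposition2p2 n _ (σ , ortho) d@(suc (suc _)) (divides k@(suc _) n≡kdd) =
  ⊥-elim (NoSquareDivisor.impossible ortho (pred (k * d)) d (s≤s (s≤s z≤n))
            (trans n≡kdd (sym (*-assoc k d d))) (n∣m*n k))
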